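{- Let $w,w'\in S_n$, $\alpha=\mathsf{code}(w)$ and $\alpha'=\mathsf{code}(w')$. Suppose that $\alpha$ covers $\alpha'$ in positions $(i,j)$ and that $\alpha_i>\alpha'_i+1$. Then for every $k\in[i+1,j-1]$ and every $m\in[\alpha'_i+1,\alpha_i-1]$, the following identities hold in $S_n$: $$s_{m+i}\cdot R_i(w')=R_i(w')\cdot s_{m+i},\qquad s_{m+k-1-c_{i,k}(\alpha)}\cdot R_k(w)=R_k(w)\cdot s_{m+k-c_{i,k+1}(\alpha)}.$$
   Context: $[a,b]=\{a,\dots,b\}$. $S_n$ is the symmetric group with simple transpositions $s_i=(i,i+1)$. The code of $w\in S_n$ is $\mathsf{code}(w)=(\alpha_1,\dots,\alpha_{n-1})$ with $\alpha_i=\#\{k>i:w(k)<w(i)\}$. For $w\in S_n$ with $\alpha=\mathsf{code}(w)$ and $i\in[n-1]$, the $i$-th row reading is $R_i(w)=s_{\alpha_i+i-1}s_{\alpha_i+i-2}\cdots s_{i+1}s_i$ if $\alpha_i\neq0$ and $R_i(w)=e$ (identity) if $\alpha_i=0$. A (weak) composition is a finite sequence of nonnegative integers $(\alpha_1,\dots,\alpha_m)$ with $\alpha_k=0$ for $k>m$; $|\alpha|=\sum\alpha_k$. For a composition $\alpha$, a positive integer $i$ and $j\in\mathbb{N}$: $c_{i,j}(\alpha)=0$ if $j\leqslant i+1$; for $j>i+1$, $c_{i,j}(\alpha)=c_{i,j-1}(\alpha)+1$ if $\alpha_{j-1}<\alpha_i-c_{i,j-1}(\alpha)$ and $c_{i,j}(\alpha)=c_{i,j-1}(\alpha)$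 otherwise. For compositions with $|\alpha|=|\alpha'|+1$ and positive integers $i<j$, $\alpha$ covers $\alpha'$ in positions $(i,j)$ if: (a1) $\alpha'_i\leqslant\alpha_i-1$; (a2) $\alpha'_j=\alpha_j+\alpha_i-\alpha'_i-1$; (a3) $\alpha'_k=\alpha_k$ for $k\neq i,j$; (a4) $c_{i,j}(\alpha)=c_{i,j}(\alpha')=\alpha'_i-\alpha_j$. -}

module Defs where

open import Data.Nat using (ℕ; zero; suc; _+_; _∸_; _≤_; _<_; _<?_; _≤?_; _≟_)
open import Data.Nat.Properties using (≤-refl)
open import Data.Fin using (Fin; toℕ; fromℕ<)
open import Data.Fin.Permutation using (Permutation′; _∘ₚ_; transpose; _⟨$⟩ʳ_; _≈_)
  renaming (id to idₚ)
open import Data.List using (List; []; _∷_; map; upTo; reverse; foldr; length; filter)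
open import Data.Nat.ListAction using (sum)
open import Data.Bool using (if_then_else_)
open import Relation.Nullary using (does; yes; no)
open import Relation.Binary.PropositionalEquality using (_≡_; _≢_)

-- The symmetric group S_n, realised as permutations of Fin n
-- (position p ∈ [1,n] corresponds to the element p-1 of Fin n).
S : ℕ → Set
S n = Permutation′ n

e : ∀ {n} → S n
e = idₚ

-- Product in S_n with the usual convention (u · v)(x) = u (v x).
infixl 7 _·_
_·_ : ∀ {n} → S n → S n → S n
u · v = v ∘ₚ u

prod : ∀ {n} → List (S n) → S n
prod = foldr _·_ e

s : ∀ {n} → ℕ → S n
s {n} zero = e
s {n} (suc i) with suc i <? n
... | yes p = transpose (fromℕ< {i} (helper p)) (fromℕ< p)
  where
    helper : suc i < n → i < n
    helper (Data.Nat.s≤s q) = Data.Nat.Properties.≤-trans (Data.Nat.Properties.n≤1+n _) (Data.Nat.s≤s q)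
... | no _  = e

-- Value w(p) of w at 1-indexed position p (0 outside [1,n]); values are
-- shifted by one as well, which does not affect comparisons.
at : ∀ {n} → S n → ℕ → ℕ
at {n} w zero = 0
at {n} w (suc p) with p <? n
... | yes q = suc (toℕ (w ⟨$⟩ʳ fromℕ< q))
... | no _  = 0

range : ℕ → ℕ → List ℕ
range i n = map (λ t → suc i + t) (upTo (n ∸ i))

-- Weak compositions, as finite lists (α_1, ..., α_m); entries beyond the
-- list (and the meaningless index 0) are 0.
Composition : Set
Composition = List ℕ

get : Composition → ℕ → ℕ
get α zero = 0
get [] (suc k) = 0
get (a ∷ α) (suc zero) = a
get (a ∷ α) (suc (suc k)) = get α (suc k)

∣_∣ : Composition → ℕ
∣ α ∣ = sum α

code : ∀ {n} → S n → Composition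
code {n} w = map α (map suc (upTo (n ∸ 1)))
  where
    α : ℕ → ℕ
    α i = length (filter (λ k → at w k <? at w i) (range i n))

R : ∀ {n} → ℕ → S n → S n
R i w = prod (map s (reverse (map (λ t → i + t) (upTo (get (code w) i)))))

c : ℕ → ℕ → Composition → ℕ
c i zero α = 0
c i (suc j) α with suc j ≤? suc i
... | yes _ = 0
... | no _  = let d = c i j α in
              if does (get α j <? get α i ∸ d) then suc d else d

record Covers (α α' : Composition) (i j : ℕ) : Set where
  field
    size : ∣ α ∣ ≡ ∣ α' ∣ + 1
    pos  : 1 ≤ i
    i<j  : i < j
    a1   : get α' i + 1 ≤ get α i
    -- (a2) α'_j = α_j + α_i - α'_i - 1   (no truncation occurs, by (a1))
    a2   : get α' j ≡ get α j + get α i ∸ get α' i ∸ 1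
    a3   : ∀ k → 1 ≤ k → k ≢ i → k ≢ j → get α' k ≡ get α k
    -- (a4) c_{i,j}(α) = c_{i,j}(α') = α'_i - α_j  (an integer equation)
    a4   : c i j α + get α j ≡ get α' i
    a4'  : c i j α' + get α j ≡ get α' i

-- Write a = α_k, so that R_k(w) = s_{k+a-1} ⋯ s_k.  A transposition s_b commutes with
-- this word when b > k + a, and is conjugated by it to s_{b+1} when k ≤ b ≤ k + a - 2.
-- The first identity is the commuting case.  For the second, put C = c_{i,k}(α) and
-- b = m + k - 1 - C.  Condition (a4) pins down c_{i,k}(α') = c_{i,k}(α) for all i < k ≤ j.
-- Hence if c_{i,·}(α) increases at k, so does c_{i,·}(α'), giving α_k + C < α'_i < m: the
-- commuting case.  Otherwise α_i ≤ α_k + C and c_{i,k+1}(α) = C, and m ≤ α_i - 1 gives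
-- b ≤ k + a - 2: the conjugation case.
module Submission where

open import Defs
open import Data.Nat using (ℕ; zero; suc; _+_; _∸_; _≤_; _<_; _≮_; _<ᵇ_; _<?_; _≤?_; z≤n; s≤s)
open import Data.Nat.Properties
open import Data.Nat.Tactic.RingSolver using (solve-∀)
open import Data.Bool using (true; false)
open import Data.Fin using (Fin; toℕ)
import Data.Fin as Fin
open import Data.Fin.Properties using (toℕ-injective; toℕ-fromℕ<)
open import Data.Fin.Permutation using (_≈_; _⟨$⟩ʳ_; transpose; lift₀-transpose)
open import Data.List using (map; reverse; applyDownFrom; applyUpTo; filter; length; upTo)
open import Data.List.Properties using (map-upTo; map-applyUpTo; reverse-applyUpTo; length-filter; length-map; length-upTo)
open import Data.Product using (_×_; _,_; proj₁; proj₂)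
open import Data.Sum using (_⊎_; inj₁; inj₂)
open import Data.Empty using (⊥-elim)
open import Function using (_∘_)
open import Relation.Nullary using (¬_; yes; no; ofʸ; ofⁿ)
open import Relation.Binary.PropositionalEquality

-- The transposition (i, i+1) of ℕ, by structural recursion so that the Coxeter relations
-- below are checked by induction on i and a few closed cases.
adjacentSwap : ℕ → ℕ → ℕ
adjacentSwap zero zero = 1
adjacentSwap zero (suc zero) = 0
adjacentSwap zero (suc (suc y)) = suc (suc y)
adjacentSwap (suc i) zero = 0
adjacentSwap (suc i) (suc y) = suc (adjacentSwap i y)

adjacentSwap-commute : ∀ i j → suc (suc i) ≤ j → ∀ y →
  adjacentSwap i (adjacentSwap j y) ≡ adjacentSwap j (adjacentSwap i y)
adjacentSwap-commute zero (suc (suc j)) (s≤s (s≤s _)) zero = refl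
adjacentSwap-commute zero (suc (suc j)) (s≤s (s≤s _)) (suc zero) = refl
adjacentSwap-commute zero (suc (suc j)) (s≤s (s≤s _)) (suc (suc y)) = refl
adjacentSwap-commute (suc i) (suc j) _ zero = refl
adjacentSwap-commute (suc i) (suc j) (s≤s i+2≤j) (suc y) = cong suc (adjacentSwap-commute i j i+2≤j y)

adjacentSwap-braid : ∀ i y →
  adjacentSwap i (adjacentSwap (suc i) (adjacentSwap i y))
    ≡ adjacentSwap (suc i) (adjacentSwap i (adjacentSwap (suc i) y))
adjacentSwap-braid zero zero = refl
adjacentSwap-braid zero (suc zero) = refl
adjacentSwap-braid zero (suc (suc zero)) = refl
adjacentSwap-braid zero (suc (suc (suc y))) = refl
adjacentSwap-braid (suc i) zero = refl
adjacentSwap-braid (suc i) (suc y) = cong suc (adjacentSwap-braid i y)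

toℕ-transpose-adjacent : ∀ {n} (a b x : Fin n) → toℕ b ≡ suc (toℕ a) →
  toℕ (transpose a b ⟨$⟩ʳ x) ≡ adjacentSwap (toℕ a) (toℕ x)
toℕ-transpose-adjacent Fin.zero (Fin.suc Fin.zero) Fin.zero _ = refl
toℕ-transpose-adjacent Fin.zero (Fin.suc Fin.zero) (Fin.suc Fin.zero) _ = refl
toℕ-transpose-adjacent Fin.zero (Fin.suc Fin.zero) (Fin.suc (Fin.suc x)) _ = refl
toℕ-transpose-adjacent (Fin.suc a) (Fin.suc b) Fin.zero _ = refl
toℕ-transpose-adjacent (Fin.suc a) (Fin.suc b) (Fin.suc x) b≡1+a = begin
  toℕ (transpose (Fin.suc a) (Fin.suc b) ⟨$⟩ʳ Fin.suc x) ≡⟨ cong toℕ (lift₀-transpose a b (Fin.suc x)) ⟩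
  suc (toℕ (transpose a b ⟨$⟩ʳ x))                     ≡⟨ cong suc (toℕ-transpose-adjacent a b x (suc-injective b≡1+a)) ⟩
  suc (adjacentSwap (toℕ a) (toℕ x))                   ∎
  where open ≡-Reasoning

toℕ-s : ∀ {n} i → suc i < n → ∀ x → toℕ (s {n} (suc i) ⟨$⟩ʳ x) ≡ adjacentSwap i (toℕ x)
toℕ-s {n} i i+1<n x with suc i <? n
... | no i+1≮n = ⊥-elim (i+1≮n i+1<n)
... | yes i+1<n′ = trans (toℕ-transpose-adjacent _ _ x (trans (toℕ-fromℕ< i+1<n′) (cong suc (sym (toℕ-fromℕ< _)))))
                         (cong (λ a → adjacentSwap a (toℕ x)) (toℕ-fromℕ< _))

s-out-of-range : ∀ {n} i → n ≤ suc i → s {n} (suc i) ≈ e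
s-out-of-range {n} i n≤i+1 x with suc i <? n
... | yes i+1<n = ⊥-elim (≤⇒≯ n≤i+1 i+1<n)
... | no _ = refl

-- A record rather than a synonym for u · v ≈ v · u, so that u and v can be inferred.
record Commute {n} (u v : S n) : Set where
  constructor mkCommute
  field commute : u · v ≈ v · u
open Commute

Commute-sym : ∀ {n} {u v : S n} → Commute u v → Commute v u
Commute-sym uv = mkCommute (λ x → sym (commute uv x))

Commute-≈e : ∀ {n} {u v : S n} → u ≈ e → Commute u v
Commute-≈e {v = v} u≈e = mkCommute (λ x → trans (u≈e (v ⟨$⟩ʳ x)) (cong (v ⟨$⟩ʳ_) (sym (u≈e x))))

s-commute : ∀ {n} a b → suc (suc a) ≤ b → Commute (s {n} a) (s b)
s-commute zero b _ = Commute-≈e (λ _ → refl)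
s-commute {n} (suc i) (suc j) (s≤s i+2≤j) with <-≤-connex (suc i) n | <-≤-connex (suc j) n
... | inj₂ n≤i+1 | _ = Commute-≈e (s-out-of-range i n≤i+1)
... | inj₁ _ | inj₂ n≤j+1 = Commute-sym (Commute-≈e (s-out-of-range j n≤j+1))
... | inj₁ i+1<n | inj₁ j+1<n = mkCommute λ x → toℕ-injective (begin
  toℕ (s (suc i) ⟨$⟩ʳ (s (suc j) ⟨$⟩ʳ x))  ≡⟨ toℕ-s i i+1<n _ ⟩
  adjacentSwap i (toℕ (s (suc j) ⟨$⟩ʳ x))  ≡⟨ cong (adjacentSwap i) (toℕ-s j j+1<n x) ⟩
  adjacentSwap i (adjacentSwap j (toℕ x))  ≡⟨ adjacentSwap-commute i j i+2≤j (toℕ x) ⟩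
  adjacentSwap j (adjacentSwap i (toℕ x))  ≡⟨ cong (adjacentSwap j) (toℕ-s i i+1<n x) ⟨
  adjacentSwap j (toℕ (s (suc i) ⟨$⟩ʳ x))  ≡⟨ toℕ-s j j+1<n _ ⟨
  toℕ (s (suc j) ⟨$⟩ʳ (s (suc i) ⟨$⟩ʳ x))  ∎)
  where open ≡-Reasoning

s-braid : ∀ {n} b → 0 < b → suc b < n → s {n} b · s (suc b) · s b ≈ s (suc b) · s b · s (suc b)
s-braid {n} (suc i) _ i+2<n x = toℕ-injective (begin
  toℕ (s₁ ⟨$⟩ʳ (s₂ ⟨$⟩ʳ (s₁ ⟨$⟩ʳ x)))  ≡⟨ toℕ-s i i+1<n _ ⟩
  σ₁ (toℕ (s₂ ⟨$⟩ʳ (s₁ ⟨$⟩ʳ x)))        ≡⟨ cong σ₁ (toℕ-s (suc i) i+2<n _) ⟩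
  σ₁ (σ₂ (toℕ (s₁ ⟨$⟩ʳ x)))              ≡⟨ cong (σ₁ ∘ σ₂) (toℕ-s i i+1<n x) ⟩
  σ₁ (σ₂ (σ₁ (toℕ x)))                    ≡⟨ adjacentSwap-braid i (toℕ x) ⟩
  σ₂ (σ₁ (σ₂ (toℕ x)))                    ≡⟨ cong (σ₂ ∘ σ₁) (toℕ-s (suc i) i+2<n x) ⟨
  σ₂ (σ₁ (toℕ (s₂ ⟨$⟩ʳ x)))              ≡⟨ cong σ₂ (toℕ-s i i+1<n _) ⟨
  σ₂ (toℕ (s₁ ⟨$⟩ʳ (s₂ ⟨$⟩ʳ x)))        ≡⟨ toℕ-s (suc i) i+2<n _ ⟨
  toℕ (s₂ ⟨$⟩ʳ (s₁ ⟨$⟩ʳ (s₂ ⟨$⟩ʳ x)))  ∎)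
  where
  open ≡-Reasoning
  i+1<n : suc i < n
  i+1<n = <-trans (n<1+n (suc i)) i+2<n
  s₁ s₂ : S n
  s₁ = s (suc i)
  s₂ = s (suc (suc i))
  σ₁ σ₂ : ℕ → ℕ
  σ₁ = adjacentSwap i
  σ₂ = adjacentSwap (suc i)

Commute-· : ∀ {n} {u v v′ : S n} → Commute u v → Commute u v′ → Commute u (v · v′)
Commute-· {v = v} {v′} uv uv′ = mkCommute (λ x → trans (commute uv (v′ ⟨$⟩ʳ x)) (cong (v ⟨$⟩ʳ_) (commute uv′ x)))

row : ∀ {n} → ℕ → ℕ → S n
row k a = prod (map s (applyDownFrom (k +_) a))

R≡row : ∀ {n} i (w : S n) → R i w ≡ row i (get (code w) i)
R≡row i w = cong (prod ∘ map s)
  (trans (cong reverse (map-upTo (i +_) (get (code w) i))) (reverse-applyUpTo (i +_) (get (code w) i)))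

s-commutes-row : ∀ {n} b k a → k + a < b → Commute (s {n} b) (row k a)
s-commutes-row b k zero _ = mkCommute (λ _ → refl)
s-commutes-row b k (suc a) k+a<b = Commute-·
  (Commute-sym (s-commute (k + a) b (subst (_< b) (+-suc k a) k+a<b)))
  (s-commutes-row b k a (<-trans (+-monoʳ-< k (n<1+n a)) k+a<b))

+-suc² : ∀ m n → m + suc (suc n) ≡ suc (suc (m + n))
+-suc² m n = trans (+-suc m (suc n)) (cong suc (+-suc m n))

-- s_b moves past the factors s_{k+a-1}, …, s_{b+2}, meets s_{b+1} s_b in a braid
-- relation, and the resulting s_{b+1} moves past the remaining factors.
s-shift-row : ∀ {n} k t a → 0 < k → suc (suc t) ≤ a → k + a ≤ n →
  s {n} (k + t) · row k a ≈ row k a · s (suc (k + t))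
s-shift-row {n} k t (suc a) 0<k t+2≤a+1 k+a+1≤n with m≤n⇒m<n∨m≡n t+2≤a+1
... | inj₁ (s≤s t+2≤a) = λ x → trans
  (commute (s-commute (k + t) (k + a) (subst (_≤ k + a) (+-suc² k t) (+-monoʳ-≤ k t+2≤a))) (row k a ⟨$⟩ʳ x))
  (cong (s (k + a) ⟨$⟩ʳ_) (s-shift-row k t a 0<k t+2≤a (≤-trans (+-monoʳ-≤ k (n≤1+n a)) k+a+1≤n) x))
... | inj₂ refl rewrite +-suc k t = λ x → trans
  (s-braid (k + t) (<-≤-trans 0<k (m≤m+n k t)) (subst (_≤ n) (+-suc² k t) k+a+1≤n) (row k t ⟨$⟩ʳ x))
  (cong (λ y → s (suc (k + t)) ⟨$⟩ʳ (s (k + t) ⟨$⟩ʳ y)) (commute (s-commutes-row (suc (k + t)) k t ≤-refl) x))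

m<o∸n⇒m+n<o : ∀ m n o → m < o ∸ n → m + n < o
m<o∸n⇒m+n<o m n o m<o∸n with n ≤? o
... | yes n≤o = m≤o∸n⇒m+n≤o (suc m) n≤o m<o∸n
... | no n≰o = ⊥-elim (n≮0 (subst (m <_) (m≤n⇒m∸n≡0 (<⇒≤ (≰⇒> n≰o))) m<o∸n))

m≮o∸n⇒o≤m+n : ∀ m n o → m ≮ o ∸ n → o ≤ m + n
m≮o∸n⇒o≤m+n m n o m≮o∸n = ≮⇒≥ (λ m+n<o → m≮o∸n (m+n≤o⇒m≤o∸n (suc m) m+n<o))

c-step : ∀ i k α → i < k →
  get α k + c i k α < get α i × c i (suc k) α ≡ suc (c i k α)
  ⊎ get α i ≤ get α k + c i k α × c i (suc k) α ≡ c i k α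
c-step i k α i<k with suc k ≤? suc i
... | yes (s≤s k≤i) = ⊥-elim (<⇒≱ i<k k≤i)
... | no _ with get α k <ᵇ get α i ∸ c i k α | <ᵇ-reflects-< (get α k) (get α i ∸ c i k α)
...   | true  | ofʸ below    = inj₁ (m<o∸n⇒m+n<o _ _ _ below , refl)
...   | false | ofⁿ notBelow = inj₂ (m≮o∸n⇒o≤m+n _ _ _ notBelow , refl)

c-start : ∀ i α → c i (suc i) α ≡ 0
c-start i α with suc i ≤? suc i
... | yes _ = refl
... | no i+1≰i+1 = ⊥-elim (i+1≰i+1 ≤-refl)

c-mono : ∀ i k d α → i < k → c i k α ≤ c i (d + k) α
c-mono i k zero α i<k = ≤-refl
c-mono i k (suc d) α i<k with c-step i (d + k) α (<-≤-trans i<k (m≤n+m k d))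
... | inj₁ (_ , step) rewrite step = m≤n⇒m≤1+n (c-mono i k d α i<k)
... | inj₂ (_ , step) rewrite step = c-mono i k d α i<k

below-transfers : ∀ {a A A′ C C′} → A′ + C ≤ A + C′ → a + C′ < A′ → a + C < A
below-transfers {a} {A} {A′} {C} {C′} dom below′ = +-cancelʳ-< C′ (a + C) A (begin-strict
  a + C + C′   ≡⟨ rearrange a C C′ ⟩
  a + C′ + C   <⟨ +-monoˡ-< C below′ ⟩
  A′ + C       ≤⟨ dom ⟩
  A + C′       ∎)
  where
  open ≤-Reasoning
  rearrange : ∀ a C C′ → a + C + C′ ≡ a + C′ + C
  rearrange = solve-∀

dominance-step : ∀ {a A A′ C C′} → A′ ≤ a + C′ → a + C < A → A′ + suc C ≤ A + C′
dominance-step {a} {A} {A′} {C} {C′} notBelow′ below = begin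
  A′ + suc C       ≤⟨ +-monoˡ-≤ (suc C) notBelow′ ⟩
  a + C′ + suc C   ≡⟨ rearrange a C C′ ⟩
  suc (a + C) + C′ ≤⟨ +-monoˡ-≤ C′ below ⟩
  A + C′           ∎
  where
  open ≤-Reasoning
  rearrange : ∀ a C C′ → a + C′ + suc C ≡ suc (a + C) + C′
  rearrange = solve-∀

module _ {α α′ : Composition} {i j : ℕ} (cov : Covers α α′ i j) where
  open Covers cov

  A A′ : ℕ
  A = get α i
  A′ = get α′ i

  same-between : ∀ k → i < k → k < j → get α′ k ≡ get α k
  same-between k i<k k<j = a3 k (≤-trans pos (<⇒≤ i<k)) (>⇒≢ i<k) (<⇒≢ k<j)

  α′-below⇒α-below : ∀ k → i < k → k < j → A′ + c i k α ≤ A + c i k α′ →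
    get α′ k + c i k α′ < A′ → get α k + c i k α < A
  α′-below⇒α-below k i<k k<j dom below′ =
    below-transfers dom (subst (λ a → a + _ < A′) (same-between k i<k k<j) below′)

  -- The difference c_{i,k}(α) - c_{i,k}(α') lies in [0, α_i - α'_i]; so c_{i,·}(α') can only
  -- step where c_{i,·}(α) does, the difference never decreases, and as it vanishes at j by
  -- (a4) it vanishes on all of (i, j].
  Dominated : ℕ → Set
  Dominated k = c i k α′ ≤ c i k α × A′ + c i k α ≤ A + c i k α′

  c-dominated : ∀ k → i < k → k ≤ j → Dominated k
  c-dominated (suc k) (s≤s i≤k) k<j with m≤n⇒m<n∨m≡n i≤k
  ... | inj₂ refl rewrite c-start i α | c-start i α′ = z≤n , +-monoˡ-≤ 0 (m+n≤o⇒m≤o A′ a1)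
  ... | inj₁ i<k with c-dominated k i<k (<⇒≤ k<j) | c-step i k α i<k | c-step i k α′ i<k
  ...   | (c′≤c , dom) | inj₁ (_ , step) | inj₁ (_ , step′) rewrite step | step′ =
          s≤s c′≤c , subst₂ _≤_ (sym (+-suc A′ _)) (sym (+-suc A _)) (s≤s dom)
  ...   | (c′≤c , dom) | inj₁ (below , step) | inj₂ (notBelow′ , step′) rewrite step | step′ =
          m≤n⇒m≤1+n c′≤c , dominance-step (subst (λ a → A′ ≤ a + _) (same-between k i<k k<j) notBelow′) below
  ...   | (_ , dom) | inj₂ (notBelow , _) | inj₁ (below′ , _) =
          ⊥-elim (<⇒≱ (α′-below⇒α-below k i<k k<j dom below′) notBelow)
  ...   | dominated | inj₂ (_ , step) | inj₂ (_ , step′) rewrite step | step′ = dominated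

  c-gap-step : ∀ k → i < k → k < j → c i k α′ < c i k α → c i (suc k) α′ < c i (suc k) α
  c-gap-step k i<k k<j gap with c-step i k α i<k | c-step i k α′ i<k
  ... | inj₁ (_ , step) | inj₁ (_ , step′) rewrite step | step′ = s≤s gap
  ... | inj₁ (_ , step) | inj₂ (_ , step′) rewrite step | step′ = m<n⇒m<1+n gap
  ... | inj₂ (notBelow , _) | inj₁ (below′ , _) =
        ⊥-elim (<⇒≱ (α′-below⇒α-below k i<k k<j (proj₂ (c-dominated k i<k (<⇒≤ k<j))) below′) notBelow)
  ... | inj₂ (_ , step) | inj₂ (_ , step′) rewrite step | step′ = gap

  c-gap-persists : ∀ d k → i < k → d + k ≤ j → c i k α′ < c i k α → c i (d + k) α′ < c i (d + k) α
  c-gap-persists zero k i<k k≤j gap = gap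
  c-gap-persists (suc d) k i<k d+k<j gap =
    c-gap-step (d + k) (<-≤-trans i<k (m≤n+m k d)) d+k<j (c-gap-persists d k i<k (<⇒≤ d+k<j) gap)

  c-agree : ∀ k → i < k → k ≤ j → c i k α′ ≡ c i k α
  c-agree k i<k k≤j = ≤-antisym (proj₁ (c-dominated k i<k k≤j)) (≮⇒≥ no-gap)
    where
    cⱼ-agree : c i j α′ ≡ c i j α
    cⱼ-agree = +-cancelʳ-≡ (get α j) _ _ (trans a4' (sym a4))
    no-gap : ¬ (c i k α′ < c i k α)
    no-gap gap = <⇒≢ (subst (λ x → c i x α′ < c i x α) (m∸n+n≡m k≤j)
      (c-gap-persists (j ∸ k) k i<k (≤-reflexive (m∸n+n≡m k≤j)) gap)) cⱼ-agree

  below-threshold : ∀ k → i < k → k < j → get α k + c i k α < A → get α k + c i k α < A′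
  below-threshold k i<k k<j below with c-step i k α′ i<k
  ... | inj₁ (below′ , _) = subst₂ (λ a C → a + C < A′) (same-between k i<k k<j) (c-agree k i<k (<⇒≤ k<j)) below′
  ... | inj₂ (_ , step′) with c-step i k α i<k
  ...   | inj₂ (notBelow , _) = ⊥-elim (<⇒≱ below notBelow)
  ...   | inj₁ (_ , step) = ⊥-elim (1+n≢n (begin
          suc (c i k α)     ≡⟨ step ⟨
          c i (suc k) α     ≡⟨ c-agree (suc k) (m<n⇒m<1+n i<k) k<j ⟨
          c i (suc k) α′    ≡⟨ step′ ⟩
          c i k α′          ≡⟨ c-agree k i<k (<⇒≤ k<j) ⟩
          c i k α           ∎))
    where open ≡-Reasoning

  c-bounded : ∀ k → i < k → k ≤ j → c i k α ≤ A′
  c-bounded k i<k k≤j = begin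
    c i k α                  ≤⟨ c-mono i k (j ∸ k) α i<k ⟩
    c i (j ∸ k + k) α        ≡⟨ cong (λ x → c i x α) (m∸n+n≡m k≤j) ⟩
    c i j α                  ≤⟨ m≤m+n (c i j α) (get α j) ⟩
    c i j α + get α j        ≡⟨ a4 ⟩
    A′                       ∎
    where open ≤-Reasoning

get-applyUpTo : ∀ (f : ℕ → ℕ) N t → get (applyUpTo f N) (suc t) ≡ 0 ⊎ get (applyUpTo f N) (suc t) ≡ f t
get-applyUpTo f zero t = inj₁ refl
get-applyUpTo f (suc N) zero = inj₂ refl
get-applyUpTo f (suc N) (suc t) = get-applyUpTo (f ∘ suc) N t

inversions : ∀ {n} → S n → ℕ → ℕ
inversions {n} w i = length (filter (λ k → at w k <? at w i) (range i n))

code≡applyUpTo : ∀ {n} (w : S n) → code w ≡ applyUpTo (inversions w ∘ suc) (n ∸ 1)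
code≡applyUpTo {n} w =
  trans (cong (map (inversions w)) (map-upTo suc (n ∸ 1))) (map-applyUpTo suc (inversions w) (n ∸ 1))

inversions-bound : ∀ {n} (w : S n) i → inversions w i ≤ n ∸ i
inversions-bound {n} w i = begin
  inversions w i              ≤⟨ length-filter (λ k → at w k <? at w i) (range i n) ⟩
  length (range i n)          ≡⟨ length-map (suc i +_) (upTo (n ∸ i)) ⟩
  length (upTo (n ∸ i))       ≡⟨ length-upTo (n ∸ i) ⟩
  n ∸ i                       ∎
  where open ≤-Reasoning

code-bound : ∀ {n} (w : S n) k → get (code w) k ≤ n ∸ k
code-bound w zero = z≤n
code-bound {n} w (suc t) rewrite code≡applyUpTo w with get-applyUpTo (inversions w ∘ suc) (n ∸ 1) t
... | inj₁ vanishes = ≤-trans (≤-reflexive vanishes) z≤n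
... | inj₂ entry = ≤-trans (≤-reflexive entry) (inversions-bound w (suc t))

m≤n∸1⇒m<n : ∀ {m n} → 0 < m → m ≤ n ∸ 1 → m < n
m≤n∸1⇒m<n {n = zero} (s≤s _) ()
m≤n∸1⇒m<n {n = suc n} _ m≤n = s≤s m≤n

0<a≤n∸k⇒k+a≤n : ∀ {a k n} → 0 < a → a ≤ n ∸ k → k + a ≤ n
0<a≤n∸k⇒k+a≤n {a} {k} {n} 0<a a≤n∸k with k ≤? n
... | yes k≤n = subst (_≤ n) (+-comm a k) (m≤o∸n⇒m+n≤o a k≤n a≤n∸k)
... | no k≰n = ⊥-elim (<⇒≱ 0<a (subst (a ≤_) (m≤n⇒m∸n≡0 (<⇒≤ (≰⇒> k≰n))) a≤n∸k))

1+C+r+k∸1+C≡k+r : ∀ C r k → suc C + r + k ∸ suc C ≡ k + r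
1+C+r+k∸1+C≡k+r C r k = begin
  C + r + k ∸ C    ≡⟨ cong (_∸ C) (+-assoc C r k) ⟩
  C + (r + k) ∸ C  ≡⟨ m+n∸m≡n C (r + k) ⟩
  r + k            ≡⟨ +-comm r k ⟩
  k + r            ∎
  where open ≡-Reasoning

1+C+r+k∸C≡1+k+r : ∀ C r k → suc C + r + k ∸ C ≡ suc (k + r)
1+C+r+k∸C≡1+k+r C r k =
  trans (+-∸-assoc 1 (≤-trans (m≤m+n C r) (m≤m+n (C + r) k))) (cong suc (1+C+r+k∸1+C≡k+r C r k))

below⇒row<offset : ∀ {a C A′ r} → a + C < A′ → A′ + 1 ≤ suc C + r → a < r
below⇒row<offset {a} {C} {A′} {r} below A′<1+C+r = +-cancelʳ-< C a r (begin-strict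
  a + C   <⟨ below ⟩
  A′      ≤⟨ ≤-pred (subst (_≤ suc C + r) (+-comm A′ 1) A′<1+C+r) ⟩
  C + r   ≡⟨ +-comm C r ⟩
  r + C   ∎)
  where open ≤-Reasoning

above⇒offset+2≤row : ∀ {a C A r} → suc C + r ≤ A ∸ 1 → A ≤ a + C → suc (suc r) ≤ a
above⇒offset+2≤row {a} {C} {A} {r} 1+C+r≤A∸1 notBelow = +-cancelʳ-≤ C (suc (suc r)) a (begin
  suc (suc (r + C))  ≡⟨ cong (suc ∘ suc) (+-comm r C) ⟩
  suc (suc C + r)    ≤⟨ m≤n∸1⇒m<n (s≤s z≤n) 1+C+r≤A∸1 ⟩
  A                  ≤⟨ notBelow ⟩
  a + C              ∎)
  where open ≤-Reasoning

s-exchange-R : ∀ {n} (w w′ : S n) {i j} → Covers (code w) (code w′) i j →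
  ∀ k → i < k → k < j → ∀ m → get (code w′) i + 1 ≤ m → m ≤ get (code w) i ∸ 1 →
  s (m + k ∸ 1 ∸ c i k (code w)) · R k w ≈ R k w · s (m + k ∸ c i (suc k) (code w))
s-exchange-R {n} w w′ {i} cov k i<k k<j m A′<m m≤A∸1
  with m≤n⇒∃[o]m+o≡n (<-≤-trans (s≤s (c-bounded cov k i<k (<⇒≤ k<j))) (subst (_≤ m) (+-comm _ 1) A′<m))
... | r , refl rewrite R≡row k w | 1+C+r+k∸1+C≡k+r (c i k (code w)) r k with c-step i k (code w) i<k
...   | inj₁ (below , step) rewrite step | 1+C+r+k∸1+C≡k+r (c i k (code w)) r k =
        commute (s-commutes-row (k + r) k _ (+-monoʳ-< k (below⇒row<offset (below-threshold cov k i<k k<j below) A′<m)))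
...   | inj₂ (notBelow , step) rewrite step | 1+C+r+k∸C≡1+k+r (c i k (code w)) r k =
        s-shift-row k r _ (≤-<-trans z≤n i<k) r+2≤a (0<a≤n∸k⇒k+a≤n (≤-trans (s≤s z≤n) r+2≤a) (code-bound w k))
        where
        r+2≤a : suc (suc r) ≤ get (code w) k
        r+2≤a = above⇒offset+2≤row m≤A∸1 notBelow

proposition4p2 : ∀ (n : ℕ) (w w' : S n) (i j : ℕ)
    → Covers (code w) (code w') i j
    → get (code w') i + 1 < get (code w) i
    → ∀ (k : ℕ) → i + 1 ≤ k → k ≤ j ∸ 1
    → ∀ (m : ℕ) → get (code w') i + 1 ≤ m → m ≤ get (code w) i ∸ 1
    → (s (m + i) · R i w' ≈ R i w' · s (m + i))
      × (s (m + k ∸ 1 ∸ c i k (code w)) · R k w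
          ≈ R k w · s (m + k ∸ c i (k + 1) (code w)))
-- The hypothesis α_i > α'_i + 1 only makes the range of m nonempty.
proposition4p2 n w w′ i j cov _ k i+1≤k k≤j∸1 m A′<m m≤A∸1 = first , second
  where
  i<k : i < k
  i<k = subst (_≤ k) (+-comm i 1) i+1≤k
  k<j : k < j
  k<j = m≤n∸1⇒m<n (≤-<-trans z≤n i<k) k≤j∸1
  first : s (m + i) · R i w′ ≈ R i w′ · s (m + i)
  first rewrite R≡row i w′ = commute (s-commutes-row (m + i) i (get (code w′) i)
    (subst (i + get (code w′) i <_) (+-comm i m) (+-monoʳ-< i (subst (_≤ m) (+-comm _ 1) A′<m))))
  second : s (m + k ∸ 1 ∸ c i k (code w)) · R k w ≈ R k w · s (m + k ∸ c i (k + 1) (code w))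
  second rewrite +-comm k 1 = s-exchange-R w w′ cov k i<k k<j m A′<m m≤A∸1
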